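{- Let $\ell\ge 3$ and $r\ge 3$ be integers such that the generalised H-graph $H^\ell(r)$ satisfies $\chi_\rho(H^\ell(r))\le 5$. Then there exists a packing $5$-colouring of $H^\ell(r)$ such that, for every $i$ with $1\le i\le\ell$ and every $j$ with $0\le j\le r-1$, one of the vertices $u^i_{2j},u^i_{2j+1}$ has colour $1$.
   Context: All graphs are simple; $d_G(u,v)$ is the shortest-path distance. A packing $k$-colouring of $G$ is a map $\pi:V(G)\to\{1,\dots,k\}$ such that for distinct $u,v$, $\pi(u)=\pi(v)=i$ implies $d_G(u,v)>i$; $\chi_\rho(G)$ is the least $k$ for which a packing $k$-colouring exists. For integers $r\ge 2$ and $\ell\ge 1$, the generalised H-graph $H^\ell(r)$ has vertex set $\{u^i_j: 0\le i\le \ell+1,\ 0\le j\le 2r-1\}$ and edge set consisting of: $u^0_ju^0_{j+1}$ and $u^{\ell+1}_ju^{\ell+1}_{j+1}$ for $0\le j\le 2r-1$ (subscripts modulo $2r$); $u^i_{2j}u^i_{2j+1}$ for $1\le i\le \ell$, $0\le j\le r-1$; and $u^i_ju^{i+1}_j$ for $0\le i\le \ell$, $0\le j\le 2r-1$. -}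

module Defs where

open import Data.Nat using (ℕ; zero; suc; _+_; _*_; _≤_; _<_)
open import Data.Fin using (Fin; toℕ)
open import Data.Product using (_×_; _,_; ∃-syntax)
open import Data.Sum using (_⊎_)
open import Relation.Binary.PropositionalEquality using (_≡_; _≢_)
open import Relation.Nullary using (¬_)

-- Vertex u^i_j of H^ℓ(r) is the pair (i , j) with 0 ≤ i ≤ ℓ+1, 0 ≤ j ≤ 2r-1.
V : ℕ → ℕ → Set
V ℓ r = Fin (suc (suc ℓ)) × Fin (2 * r)

SuccMod : ℕ → ℕ → ℕ → Set
SuccMod r j j' = (j' ≡ suc j) ⊎ ((j' ≡ 0) × (suc j ≡ 2 * r))

data Edge (ℓ r : ℕ) : V ℓ r → V ℓ r → Set where
  outer0 : ∀ {i i' j j'} → toℕ i ≡ 0 → toℕ i' ≡ 0 →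
           SuccMod r (toℕ j) (toℕ j') → Edge ℓ r (i , j) (i' , j')
  outerL : ∀ {i i' j j'} → toℕ i ≡ suc ℓ → toℕ i' ≡ suc ℓ →
           SuccMod r (toℕ j) (toℕ j') → Edge ℓ r (i , j) (i' , j')
  rung   : ∀ {i i' j j'} (k : ℕ) → 1 ≤ toℕ i → toℕ i ≤ ℓ → toℕ i' ≡ toℕ i →
           toℕ j ≡ 2 * k → toℕ j' ≡ suc (2 * k) → Edge ℓ r (i , j) (i' , j')
  spoke  : ∀ {i i' j j'} → toℕ i' ≡ suc (toℕ i) → toℕ j' ≡ toℕ j →
           Edge ℓ r (i , j) (i' , j')

Adj : (ℓ r : ℕ) → V ℓ r → V ℓ r → Set
Adj ℓ r u v = Edge ℓ r u v ⊎ Edge ℓ r v u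

data Walk (ℓ r : ℕ) : V ℓ r → V ℓ r → ℕ → Set where
  here : ∀ {u} → Walk ℓ r u u 0
  step : ∀ {u v w n} → Adj ℓ r u v → Walk ℓ r v w n → Walk ℓ r u w (suc n)

DistLe : (ℓ r : ℕ) → V ℓ r → V ℓ r → ℕ → Set
DistLe ℓ r u v n = ∃[ m ] (m ≤ n × Walk ℓ r u v m)

IsPackingColouring : (ℓ r k : ℕ) → (V ℓ r → ℕ) → Set
IsPackingColouring ℓ r k π =
  (∀ v → 1 ≤ π v × π v ≤ k) ×
  (∀ u v → u ≢ v → π u ≡ π v → ¬ DistLe ℓ r u v (π u))

ChiRhoLe : (ℓ r k : ℕ) → Set
ChiRhoLe ℓ r k = ∃[ k' ] (k' ≤ k × ∃[ π ] IsPackingColouring ℓ r k' π)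

-- Starting from any packing 5-colouring, recolour with 1, one vertex at a time, every vertex that
-- is neither coloured 1 nor adjacent to a 1: no vertex within distance 1 of it has colour 1, so the
-- colouring stays a packing colouring, and in the end every vertex is coloured 1 or adjacent to a 1.
-- If neither end of an inner rung u^i_{2k} u^i_{2k+1} then had colour 1, each end would have a 1
-- directly above or below it. On the same side these two 1s would be adjacent. On opposite sides
-- they are ruled out by a finite computation: in a window of at most seven rows around the rung,
-- reaching an outer cycle when the rung is within two rows of it, an exhaustive search over the
-- colours of a dozen nearby vertices, constrained by their distances inside the window, finds no
-- packing 5-colouring.

module Submission where

open import Data.Bool using (Bool; true; false; T; not; _∧_; _∨_; if_then_else_)
open import Data.Bool.ListAction using (all; any)
open import Data.Bool.Properties using (T-∨; T-not-≡) renaming (_≟_ to _≟ᵇ_)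
open import Data.Empty using (⊥; ⊥-elim)
open import Data.Fin using (Fin; zero; suc; toℕ; fromℕ<; inject₁; #_)
import Data.Fin.Properties as Fin
open import Data.List
  using (List; []; _∷_; _++_; map; foldl; allFin; upTo; mapMaybe; cartesianProduct; length)
open import Data.List.Membership.Propositional using (_∈_)
open import Data.List.Membership.Propositional.Properties using (∈-allFin; ∈-cartesianProduct⁺)
open import Data.List.Relation.Unary.All as All using (All; []; _∷_)
open import Data.List.Relation.Unary.All.Properties using (all⁺; all⁻; map⁺)
open import Data.List.Relation.Unary.Any using (here; there; satisfied)
open import Data.List.Relation.Unary.Any.Properties using (any⁻)
open import Data.Maybe as Maybe using (Maybe; just; nothing)
open import Data.Nat using (ℕ; zero; suc; _+_; _*_; _∸_; _≤_; _<_; z≤n; s≤s; s≤s⁻¹; _≡ᵇ_; _≤ᵇ_; _≤?_; _<?_)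
open import Data.Nat.Divisibility using (divides; _∣?_)
open import Data.Nat.Properties
  using (_≟_; suc-injective; 1+n≢n; even≢odd; *-suc; *-comm; *-cancelˡ-≡; *-cancelˡ-<; *-monoʳ-≤;
         +-monoˡ-≤; +-cancelʳ-≡; +-∸-assoc; ∸-cancelˡ-≡; m∸n≤m; ≤-refl; ≤-reflexive; ≤-trans; <-trans;
         <-irrefl; <⇒≢; ≤∧≢⇒<; n<1+n; n≤1+n; m≤n⇒m<n∨m≡n; ≡ᵇ⇒≡; ≡⇒≡ᵇ; ≤ᵇ⇒≤)
open import Data.Product using (Σ; ∃; ∃-syntax; _×_; _,_; proj₁; proj₂)
open import Data.Product.Properties using (≡-dec)
open import Data.Sum using (_⊎_; inj₁; inj₂; [_,_]; swap)
open import Data.Unit using (⊤; tt)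
open import Function using (_∘_; Equivalence)
open import Relation.Binary.Definitions using (Decidable; DecidableEquality)
open import Relation.Binary.PropositionalEquality
  using (_≡_; _≢_; refl; sym; trans; cong; cong₂; subst; subst₂; module ≡-Reasoning)
open import Relation.Nullary using (¬_; Dec; yes; no; does; contradiction)
open import Relation.Nullary.Decidable using (_×-dec_; _⊎-dec_; map′; T?)

open import Defs

-- Exhaustive search with pruning

-- A constraint in layer m of a search forbids indices src and m to share a colour ≥ len.
record Constraint : Set where
  constructor constraint
  field
    src len : ℕ

open Constraint

_[_≔_] : (ℕ → ℕ) → ℕ → ℕ → ℕ → ℕ
(σ [ m ≔ a ]) z = if z ≡ᵇ m then a else σ z

respects : (ℕ → ℕ) → ℕ → Constraint → Bool
respects σ m c = not ((σ (src c) ≡ᵇ σ m) ∧ (len c ≤ᵇ σ m))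

refutes : List (List Constraint) → (ℕ → List ℕ) → ℕ → (ℕ → ℕ) → Bool
refutes []         choices m σ = false
refutes (cs ∷ css) choices m σ = all extends (choices m)
  where
  extends : ℕ → Bool
  extends a = not (all (respects (σ [ m ≔ a ]) m) cs) ∨ refutes css choices (suc m) (σ [ m ≔ a ])

Satisfies : (ℕ → ℕ) → ℕ → List (List Constraint) → Set
Satisfies σ m []         = ⊤
Satisfies σ m (cs ∷ css) = All (λ c → src c < m × T (respects σ m c)) cs × Satisfies σ (suc m) css

update-same : ∀ σ m a → (σ [ m ≔ a ]) m ≡ a
update-same σ m a with m ≡ᵇ m in m≡ᵇm
... | true  = refl
... | false = ⊥-elim (subst T m≡ᵇm (≡⇒≡ᵇ m m refl))

update-other : ∀ σ {m z} a → z ≢ m → (σ [ m ≔ a ]) z ≡ σ z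
update-other σ {m} {z} a z≢m with z ≡ᵇ m in z≡ᵇm
... | true  = contradiction (≡ᵇ⇒≡ z m (subst T (sym z≡ᵇm) tt)) z≢m
... | false = refl

respects-intro : ∀ σ m c → (σ (src c) ≡ σ m → len c ≤ σ m → ⊥) → T (respects σ m c)
respects-intro σ m c clash with σ (src c) ≡ᵇ σ m in same | len c ≤ᵇ σ m in long
... | true  | true  = clash (≡ᵇ⇒≡ _ _ (subst T (sym same) tt)) (≤ᵇ⇒≤ _ _ (subst T (sym long) tt))
... | true  | false = tt
... | false | _     = tt

respects-transfer : ∀ τ σ m c → τ (src c) ≡ σ (src c) → τ m ≡ σ m → T (respects σ m c) → T (respects τ m c)
respects-transfer τ σ m c e e′ = subst T (sym (cong₂ (λ a b → not ((a ≡ᵇ b) ∧ (len c ≤ᵇ b))) e e′))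

module _ (choices : ℕ → List ℕ) (σ : ℕ → ℕ) (σ-choices : ∀ m → σ m ∈ choices m) where

  AgreesBelow : (ℕ → ℕ) → ℕ → Set
  AgreesBelow τ m = ∀ {z} → z < m → τ z ≡ σ z

  agrees-extend : ∀ {τ m} → AgreesBelow τ m → AgreesBelow (τ [ m ≔ σ m ]) (suc m)
  agrees-extend {τ} {m} agree z<1+m with m≤n⇒m<n∨m≡n (s≤s⁻¹ z<1+m)
  ... | inj₁ z<m  = trans (update-other τ (σ m) (<⇒≢ z<m)) (agree z<m)
  ... | inj₂ refl = update-same τ m (σ m)

  refutes-sound : ∀ {css m τ} → Satisfies σ m css → AgreesBelow τ m → ¬ T (refutes css choices m τ)
  refutes-sound {[]}       _               _     ()
  refutes-sound {cs ∷ css} {m} {τ} (layer , rest) agree t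
    with Equivalence.to T-∨ (All.lookup (all⁺ _ _ t) (σ-choices m))
  ... | inj₂ deeper = refutes-sound rest (agrees-extend agree) deeper
  ... | inj₁ broken =
    subst T (Equivalence.to T-not-≡ broken) (all⁻ (respects τ′ m) (All.map (λ {c} → kept {c}) layer))
    where
    τ′ = τ [ m ≔ σ m ]
    kept : ∀ {c} → src c < m × T (respects σ m c) → T (respects τ′ m c)
    kept {c} (s<m , ok) =
      respects-transfer τ′ σ m c (agrees-extend agree (<-trans s<m (n<1+n m)))
                                 (agrees-extend agree (n<1+n m)) ok

one-to-five : ∀ {a} → 1 ≤ a → a ≤ 5 → a ∈ 1 ∷ 2 ∷ 3 ∷ 4 ∷ 5 ∷ []
one-to-five {1} _ _ = here refl
one-to-five {2} _ _ = there (here refl)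
one-to-five {3} _ _ = there (there (here refl))
one-to-five {4} _ _ = there (there (there (here refl)))
one-to-five {5} _ _ = there (there (there (there (here refl))))
one-to-five {suc (suc (suc (suc (suc (suc _)))))} _ (s≤s (s≤s (s≤s (s≤s (s≤s ())))))

-- Local windows of the graph

data Pair : Set where
  previous current next : Pair

_≟ₚ_ : DecidableEquality Pair
previous ≟ₚ previous = yes refl
previous ≟ₚ current  = no λ ()
previous ≟ₚ next     = no λ ()
current  ≟ₚ previous = no λ ()
current  ≟ₚ current  = yes refl
current  ≟ₚ next     = no λ ()
next     ≟ₚ previous = no λ ()
next     ≟ₚ current  = no λ ()
next     ≟ₚ next     = yes refl

data Follows : Pair → Pair → Set where
  previous-current : Follows previous current
  current-next     : Follows current next

-- (p , false) and (p , true) are the even and odd column of the pair p.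
Column : Set
Column = Pair × Bool

pattern prev₀ = previous , false
pattern prev₁ = previous , true
pattern cur₀  = current  , false
pattern cur₁  = current  , true
pattern next₀ = next     , false
pattern next₁ = next     , true

successor : ∀ {n} (d : Fin n) → Maybe (Σ (Fin n) λ d′ → toℕ d′ ≡ suc (toℕ d))
successor {suc zero}    zero    = nothing
successor {suc (suc n)} zero    = just (suc zero , refl)
successor {suc (suc n)} (suc d) = Maybe.map (λ (d′ , e) → suc d′ , cong suc e) (successor d)

-- Rows 0, …, D of three consecutive column pairs; with ring set, row 0 lies on an outer cycle.
module Window (D : ℕ) (ring : Bool) where

  Site : Set
  Site = Fin (suc D) × Column

  _≟ₛ_ : DecidableEquality Site
  _≟ₛ_ = ≡-dec Fin._≟_ (≡-dec _≟ₚ_ _≟ᵇ_)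

  SiteEdge : Site → Site → Set
  SiteEdge (d , p , s) (d′ , p′ , s′) =
      (toℕ d′ ≡ suc (toℕ d) × p ≡ p′ × s ≡ s′)
    ⊎ (d ≡ d′ × p ≡ p′ × s ≡ false × s′ ≡ true)
    ⊎ (T ring × toℕ d ≡ 0 × toℕ d′ ≡ 0 × Follows p p′ × s ≡ true × s′ ≡ false)

  SiteAdj : Site → Site → Set
  SiteAdj x y = SiteEdge x y ⊎ SiteEdge y x

  vertical : (x : Site) → List (∃ (SiteAdj x))
  vertical (d , c) = below (successor d) ++ above d
    where
    below : Maybe (Σ (Fin (suc D)) λ d′ → toℕ d′ ≡ suc (toℕ d)) → List (∃ (SiteAdj (d , c)))
    below nothing         = []
    below (just (d′ , e)) = ((d′ , c) , inj₁ (inj₁ (e , refl , refl))) ∷ []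
    above : (d : Fin (suc D)) → List (∃ (SiteAdj (d , c)))
    above zero    = []
    above (suc d) = ((inject₁ d , c) , inj₂ (inj₁ (cong suc (sym (Fin.toℕ-inject₁ d)) , refl , refl))) ∷ []

  partner : (x : Site) → ∃ (SiteAdj x)
  partner (d , p , false) = (d , p , true)  , inj₁ (inj₂ (inj₁ (refl , refl , refl , refl)))
  partner (d , p , true)  = (d , p , false) , inj₂ (inj₂ (inj₁ (refl , refl , refl , refl)))

  along-ring : (x : Site) → List (∃ (SiteAdj x))
  along-ring (d , p , s) with T? ring | toℕ d ≟ 0
  along-ring (d , previous , true)  | yes t | yes z =
    ((d , current , false) , inj₁ (inj₂ (inj₂ (t , z , z , previous-current , refl , refl)))) ∷ []
  along-ring (d , current , true)   | yes t | yes z =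
    ((d , next , false)    , inj₁ (inj₂ (inj₂ (t , z , z , current-next , refl , refl)))) ∷ []
  along-ring (d , current , false)  | yes t | yes z =
    ((d , previous , true) , inj₂ (inj₂ (inj₂ (t , z , z , previous-current , refl , refl)))) ∷ []
  along-ring (d , next , false)     | yes t | yes z =
    ((d , current , true)  , inj₂ (inj₂ (inj₂ (t , z , z , current-next , refl , refl)))) ∷ []
  along-ring _ | _ | _ = []

  neighbours : (x : Site) → List (∃ (SiteAdj x))
  neighbours x = partner x ∷ vertical x ++ along-ring x

  within : ℕ → Site → Site → Bool
  within zero    x y = does (x ≟ₛ y)
  within (suc n) x y = does (x ≟ₛ y) ∨ any (λ (z , _) → within n z y) (neighbours x)

  shortest : ℕ → ℕ → (x y : Site) → Maybe (∃ λ l → T (within l x y))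
  shortest zero    l x y = nothing
  shortest (suc f) l x y with T? (within l x y)
  ... | yes near = just (l , near)
  ... | no _     = shortest f (suc l) x y

  Certified : (ℕ → Site) → ℕ → Constraint → Set
  Certified v m c = src c < m × v (src c) ≢ v m × T (within (len c) (v (src c)) (v m))

  -- Colours are at most 5, so only distances up to 5 constrain a colouring.
  certify : (v : ℕ → Site) (m x : ℕ) → Maybe (Σ Constraint (Certified v m))
  certify v m x with x <? m | v x ≟ₛ v m | shortest 5 1 (v x) (v m)
  ... | yes x<m | no v≢ | just (l , near) = just (constraint x l , x<m , v≢ , near)
  ... | _       | _     | _              = nothing

  infixr 5 _∷_
  data Layers (v : ℕ → Site) (m : ℕ) : Set where
    []  : Layers v m
    _∷_ : List (Σ Constraint (Certified v m)) → Layers v (suc m) → Layers v m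

  layers : (v : ℕ → Site) (m n : ℕ) → Layers v m
  layers v m zero    = []
  layers v m (suc n) = mapMaybe (certify v m) (upTo m) ∷ layers v (suc m) n

  forget : ∀ {v m} → Layers v m → List (List Constraint)
  forget []       = []
  forget (cs ∷ L) = map proj₁ cs ∷ forget L

  siteAt : List Site → ℕ → Site
  siteAt []       _       = zero , cur₀
  siteAt (x ∷ xs) zero    = x
  siteAt (x ∷ xs) (suc m) = siteAt xs m

  -- The first two sites of a configuration carry colour 1, the next two do not.
  choices : ℕ → List ℕ
  choices 0 = 1 ∷ []
  choices 1 = 1 ∷ []
  choices 2 = 2 ∷ 3 ∷ 4 ∷ 5 ∷ []
  choices 3 = 2 ∷ 3 ∷ 4 ∷ 5 ∷ []
  choices _ = 1 ∷ 2 ∷ 3 ∷ 4 ∷ 5 ∷ []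

  Refuted : List Site → Bool
  Refuted sites = refutes (forget (layers (siteAt sites) 0 (length sites))) choices 0 (λ _ → 0)

  record Refutation (sites : List Site) : Set where
    constructor refutation
    field
      refuted : T (Refuted sites)

  split : (e o c : Fin (suc D)) → List Site → List Site
  split e o c rest = (e , cur₀) ∷ (o , cur₁) ∷ (c , cur₀) ∷ (c , cur₁) ∷ rest

-- split e o c rest lists a 1 in row e of the even column, a 1 in row o of the odd column and
-- the rung in row c; the sites in rest are only there to make the exhaustive search close.

module Rim    = Window 4 true
module Middle = Window 6 false

rim-1-even-above : Rim.Refutation (Rim.split (# 0) (# 2) (# 1)
  ((# 0 , prev₁) ∷ (# 0 , cur₁) ∷ (# 0 , next₀) ∷ (# 1 , next₀) ∷ (# 2 , cur₀) ∷ (# 3 , cur₀) ∷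
   (# 3 , cur₁) ∷ (# 4 , cur₀) ∷ []))
rim-1-even-above = Rim.refutation tt

rim-1-even-below : Rim.Refutation (Rim.split (# 2) (# 0) (# 1)
  ((# 0 , prev₁) ∷ (# 0 , cur₀) ∷ (# 0 , next₀) ∷ (# 1 , prev₁) ∷ (# 2 , cur₁) ∷ (# 3 , cur₀) ∷
   (# 3 , cur₁) ∷ (# 4 , cur₁) ∷ []))
rim-1-even-below = Rim.refutation tt

rim-2-even-above : Rim.Refutation (Rim.split (# 1) (# 3) (# 2)
  ((# 0 , cur₀) ∷ (# 0 , cur₁) ∷ (# 0 , next₀) ∷ (# 0 , next₁) ∷ (# 1 , cur₁) ∷ (# 1 , next₀) ∷
   (# 1 , next₁) ∷ (# 2 , next₀) ∷ (# 3 , cur₀) ∷ (# 4 , cur₁) ∷ []))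
rim-2-even-above = Rim.refutation tt

rim-2-even-below : Rim.Refutation (Rim.split (# 3) (# 1) (# 2)
  ((# 0 , prev₀) ∷ (# 0 , prev₁) ∷ (# 0 , cur₀) ∷ (# 0 , cur₁) ∷ (# 1 , prev₀) ∷ (# 1 , prev₁) ∷
   (# 1 , cur₀) ∷ (# 2 , prev₁) ∷ (# 3 , cur₁) ∷ (# 4 , cur₀) ∷ []))
rim-2-even-below = Rim.refutation tt

middle-even-above : Middle.Refutation (Middle.split (# 2) (# 4) (# 3)
  ((# 0 , cur₁) ∷ (# 1 , cur₀) ∷ (# 1 , cur₁) ∷ (# 2 , cur₁) ∷ (# 4 , cur₀) ∷ (# 5 , cur₀) ∷
   (# 5 , cur₁) ∷ (# 6 , cur₀) ∷ []))
middle-even-above = Middle.refutation tt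

middle-even-below : Middle.Refutation (Middle.split (# 4) (# 2) (# 3)
  ((# 0 , cur₀) ∷ (# 1 , cur₀) ∷ (# 1 , cur₁) ∷ (# 2 , cur₀) ∷ (# 4 , cur₁) ∷ (# 5 , cur₀) ∷
   (# 5 , cur₁) ∷ (# 6 , cur₁) ∷ []))
middle-even-below = Middle.refutation tt

-- Pair k occupies columns 2k and 2k+1; before and after are its neighbouring pairs along the
-- outer cycles, counted modulo r.
record Columns (r k : ℕ) : Set where
  field
    before after     : ℕ
    before<r         : before < r
    k<r              : k < r
    after<r          : after < r
    before≢k         : before ≢ k
    after≢k          : after ≢ k
    before≢after     : before ≢ after
    before-follows   : SuccMod r (suc (2 * before)) (2 * k)
    after-follows    : SuccMod r (suc (2 * k)) (2 * after)

cyclic-columns : ∀ {r k} → 3 ≤ r → k < r → Columns r k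
cyclic-columns {suc (suc (suc n))} {zero} _ 0<r = record
  { before = suc (suc n) ; after = 1
  ; before<r = ≤-refl ; k<r = 0<r ; after<r = s≤s (s≤s z≤n)
  ; before≢k = λ () ; after≢k = λ () ; before≢after = λ ()
  ; before-follows = inj₂ (refl , sym (*-suc 2 (suc (suc n))))
  ; after-follows = inj₁ refl }
cyclic-columns {suc zero}       {zero} (s≤s ())
cyclic-columns {suc (suc zero)} {zero} (s≤s (s≤s ()))
cyclic-columns {r} {suc k} 3≤r 1+k<r with suc (suc k) ≟ r
... | yes 2+k≡r = record
  { before = k ; after = 0
  ; before<r = <-trans (n<1+n k) 1+k<r ; k<r = 1+k<r ; after<r = ≤-trans (s≤s z≤n) 1+k<r
  ; before≢k = <⇒≢ (n<1+n k) ; after≢k = λ () ; before≢after = k≢0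
  ; before-follows = inj₁ (*-suc 2 k)
  ; after-follows = inj₂ (refl , trans (sym (*-suc 2 (suc k))) (cong (2 *_) 2+k≡r)) }
  where
  k≢0 : k ≢ 0
  k≢0 refl = contradiction (subst (3 ≤_) (sym 2+k≡r) 3≤r) λ { (s≤s (s≤s ())) }
... | no 2+k≢r = record
  { before = k ; after = suc (suc k)
  ; before<r = <-trans (n<1+n k) 1+k<r ; k<r = 1+k<r ; after<r = ≤∧≢⇒< 1+k<r 2+k≢r
  ; before≢k = <⇒≢ (n<1+n k) ; after≢k = 1+n≢n ; before≢after = <⇒≢ (s≤s (n≤1+n k))
  ; before-follows = inj₁ (*-suc 2 k)
  ; after-follows = inj₁ (*-suc 2 (suc k)) }

-- The graph H^ℓ(r)

module Graph (ℓ r : ℕ) where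

  row col : V ℓ r → ℕ
  row (i , _) = toℕ i
  col (_ , j) = toℕ j

  vertex-≡ : ∀ {u v} → row u ≡ row v → col u ≡ col v → u ≡ v
  vertex-≡ {_ , _} {_ , _} e e′ = cong₂ _,_ (Fin.toℕ-injective e) (Fin.toℕ-injective e′)

  distLe-step : ∀ {u v w n} → Adj ℓ r u v → DistLe ℓ r v w n → DistLe ℓ r u w (suc n)
  distLe-step adj (m , m≤n , walk) = suc m , s≤s m≤n , step adj walk

  distLe-weaken : ∀ {u v n n′} → n ≤ n′ → DistLe ℓ r u v n → DistLe ℓ r u v n′
  distLe-weaken n≤n′ (m , m≤n , walk) = m , ≤-trans m≤n n≤n′ , walk

  distLe-1 : ∀ {u w} → DistLe ℓ r u w 1 → u ≡ w ⊎ Adj ℓ r u w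
  distLe-1 (0 , _ , here)               = inj₁ refl
  distLe-1 (1 , _ , step adj here)      = inj₂ adj
  distLe-1 (suc (suc _) , s≤s () , _)

  succMod-irreflexive : ∀ {j} → ¬ SuccMod r j j
  succMod-irreflexive (inj₁ j≡1+j)         = 1+n≢n (sym j≡1+j)
  succMod-irreflexive (inj₂ (refl , 1≡2r)) = even≢odd r 0 (sym 1≡2r)

  edge-irreflexive : ∀ {u} → ¬ Edge ℓ r u u
  edge-irreflexive (outer0 _ _ j→j)        = succMod-irreflexive j→j
  edge-irreflexive (outerL _ _ j→j)        = succMod-irreflexive j→j
  edge-irreflexive (rung k _ _ _ even odd) = even≢odd k k (trans (sym even) odd)
  edge-irreflexive (spoke i≡1+i _)         = 1+n≢n (sym i≡1+i)

  adjacent-distinct : ∀ {u v} → Adj ℓ r u v → u ≢ v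
  adjacent-distinct adj refl = [ edge-irreflexive , edge-irreflexive ] adj

  -- The columns 2q and 2q+1 are joined in every row: by a rung inside, by the cycle on the rim.
  pair-adjacent : ∀ {u v} q → row v ≡ row u → col u ≡ 2 * q → col v ≡ suc (2 * q) → Adj ℓ r u v
  pair-adjacent {i , j} {i′ , j′} q same even odd = inj₁ (edge (toℕ i) refl (Fin.toℕ≤pred[n] i))
    where
    successive : SuccMod r (toℕ j) (toℕ j′)
    successive = inj₁ (trans odd (cong suc (sym even)))
    edge : ∀ a → toℕ i ≡ a → a ≤ suc ℓ → Edge ℓ r (i , j) (i′ , j′)
    edge zero    i≡a _ = outer0 i≡a (trans same i≡a) successive
    edge (suc a) i≡a (s≤s a≤ℓ) with a ≟ ℓ
    ... | yes refl = outerL i≡a (trans same i≡a) successive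
    ... | no a≢ℓ  = rung q (subst (1 ≤_) (sym i≡a) (s≤s z≤n)) (subst (_≤ ℓ) (sym i≡a) (≤∧≢⇒< a≤ℓ a≢ℓ))
                         same even odd

  Packing : ℕ → (V ℓ r → ℕ) → Set
  Packing = IsPackingColouring ℓ r

  packing-mono : ∀ {k k′ π} → k ≤ k′ → Packing k π → Packing k′ π
  packing-mono k≤k′ (range , packed) = (λ v → proj₁ (range v) , ≤-trans (proj₂ (range v)) k≤k′) , packed

  ones-nonadjacent : ∀ {k π u v} → Packing k π → Adj ℓ r u v → π u ≡ 1 → π v ≡ 1 → ⊥
  ones-nonadjacent {u = u} {v} (_ , packed) adj one one′ =
    packed u v (adjacent-distinct adj) (trans one (sym one′)) (1 , ≤-reflexive (sym one) , step adj here)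

  IsRung : ℕ → ℕ → Set
  IsRung j j′ = ∃[ k ] (j ≡ 2 * k × j′ ≡ suc (2 * k))

  isRung? : ∀ j j′ → Dec (IsRung j j′)
  isRung? j j′ with 2 ∣? j | j′ ≟ suc j
  ... | yes (divides k refl) | yes refl = yes (k , *-comm k 2 , cong suc (*-comm k 2))
  ... | no 2∤j               | _        = no λ (k , even , _) → 2∤j (divides k (trans even (*-comm 2 k)))
  ... | yes _                | no j′≢   = no λ (k , even , odd) → j′≢ (trans odd (cong suc (sym even)))

  succMod? : ∀ j j′ → Dec (SuccMod r j j′)
  succMod? j j′ = j′ ≟ suc j ⊎-dec (j′ ≟ 0 ×-dec suc j ≟ 2 * r)

  EdgeCases : V ℓ r → V ℓ r → Set
  EdgeCases (i , j) (i′ , j′) =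
      (toℕ i ≡ 0 × toℕ i′ ≡ 0 × SuccMod r (toℕ j) (toℕ j′))
    ⊎ (toℕ i ≡ suc ℓ × toℕ i′ ≡ suc ℓ × SuccMod r (toℕ j) (toℕ j′))
    ⊎ (1 ≤ toℕ i × toℕ i ≤ ℓ × toℕ i′ ≡ toℕ i × IsRung (toℕ j) (toℕ j′))
    ⊎ (toℕ i′ ≡ suc (toℕ i) × toℕ j′ ≡ toℕ j)

  edge? : Decidable (Edge ℓ r)
  edge? (i , j) (i′ , j′) = map′ from to cases?
    where
    cases? : Dec (EdgeCases (i , j) (i′ , j′))
    cases? =     (toℕ i ≟ 0 ×-dec toℕ i′ ≟ 0 ×-dec succMod? (toℕ j) (toℕ j′))
           ⊎-dec (toℕ i ≟ suc ℓ ×-dec toℕ i′ ≟ suc ℓ ×-dec succMod? (toℕ j) (toℕ j′))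
           ⊎-dec (1 ≤? toℕ i ×-dec toℕ i ≤? ℓ ×-dec toℕ i′ ≟ toℕ i ×-dec isRung? (toℕ j) (toℕ j′))
           ⊎-dec (toℕ i′ ≟ suc (toℕ i) ×-dec toℕ j′ ≟ toℕ j)
    from : EdgeCases (i , j) (i′ , j′) → Edge ℓ r (i , j) (i′ , j′)
    from (inj₁ (a , b , c))                            = outer0 a b c
    from (inj₂ (inj₁ (a , b , c)))                     = outerL a b c
    from (inj₂ (inj₂ (inj₁ (a , b , c , k , d , e)))) = rung k a b c d e
    from (inj₂ (inj₂ (inj₂ (a , b))))                  = spoke a b
    to : Edge ℓ r (i , j) (i′ , j′) → EdgeCases (i , j) (i′ , j′)
    to (outer0 a b c)     = inj₁ (a , b , c)
    to (outerL a b c)     = inj₂ (inj₁ (a , b , c))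
    to (rung k a b c d e) = inj₂ (inj₂ (inj₁ (a , b , c , k , d , e)))
    to (spoke a b)        = inj₂ (inj₂ (inj₂ (a , b)))

  adjacent? : Decidable (Adj ℓ r)
  adjacent? u v = edge? u v ⊎-dec edge? v u

  _≟ᵥ_ : DecidableEquality (V ℓ r)
  _≟ᵥ_ = ≡-dec Fin._≟_ Fin._≟_

  Dominated : (V ℓ r → ℕ) → V ℓ r → Set
  Dominated π v = π v ≡ 1 ⊎ ∃[ u ] (Adj ℓ r v u × π u ≡ 1)

  Dominating : (V ℓ r → ℕ) → Set
  Dominating π = ∀ v → Dominated π v

  dominated? : ∀ π v → Dec (Dominated π v)
  dominated? π v = π v ≟ 1 ⊎-dec map′ (λ (i , j , h) → (i , j) , h) (λ ((i , j) , h) → i , j , h)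
    (Fin.any? λ i → Fin.any? λ j → adjacent? v (i , j) ×-dec π (i , j) ≟ 1)

  recolour : (V ℓ r → ℕ) → V ℓ r → V ℓ r → ℕ
  recolour π v w with w ≟ᵥ v
  ... | yes _ = 1
  ... | no _  = π w

  recolour-packing : ∀ {k π v} → Packing (suc k) π → ¬ Dominated π v → Packing (suc k) (recolour π v)
  recolour-packing {k} {π} {v} (range , packed) undominated = range′ , packed′
    where
    range′ : ∀ w → 1 ≤ recolour π v w × recolour π v w ≤ suc k
    range′ w with w ≟ᵥ v
    ... | yes _ = s≤s z≤n , s≤s z≤n
    ... | no _  = range w
    packed′ : ∀ u w → u ≢ w → recolour π v u ≡ recolour π v w → ¬ DistLe ℓ r u w (recolour π v u)
    packed′ u w u≢w same near with u ≟ᵥ v | w ≟ᵥ v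
    ... | yes refl | yes refl = u≢w refl
    ... | yes refl | no _     = [ u≢w , (λ adj → undominated (inj₂ (w , adj , sym same))) ] (distLe-1 near)
    ... | no _     | yes refl = [ u≢w , (λ adj → undominated (inj₂ (u , swap adj , same))) ]
                                  (distLe-1 (subst (DistLe ℓ r u w) same near))
    ... | no _     | no _     = packed u w u≢w same near

  dominate : (V ℓ r → ℕ) → V ℓ r → V ℓ r → ℕ
  dominate π v with dominated? π v
  ... | yes _ = π
  ... | no _  = recolour π v

  dominate-packing : ∀ {k π v} → Packing (suc k) π → Packing (suc k) (dominate π v)
  dominate-packing {π = π} {v} packing with dominated? π v
  ... | yes _           = packing
  ... | no undominated = recolour-packing packing undominated

  dominate-dominated : ∀ π v → Dominated (dominate π v) v
  dominate-dominated π v with dominated? π v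
  ... | yes dominated = dominated
  ... | no _ with v ≟ᵥ v
  ...   | yes _   = inj₁ refl
  ...   | no v≢v = contradiction refl v≢v

  OnesKept : (V ℓ r → ℕ) → (V ℓ r → ℕ) → Set
  OnesKept π π′ = ∀ w → π w ≡ 1 → π′ w ≡ 1

  dominate-keeps-ones : ∀ π v → OnesKept π (dominate π v)
  dominate-keeps-ones π v w one with dominated? π v
  ... | yes _ = one
  ... | no _ with w ≟ᵥ v
  ...   | yes _ = refl
  ...   | no _  = one

  dominated-mono : ∀ {π π′ v} → OnesKept π π′ → Dominated π v → Dominated π′ v
  dominated-mono kept (inj₁ one)              = inj₁ (kept _ one)
  dominated-mono kept (inj₂ (u , adj , one)) = inj₂ (u , adj , kept u one)

  dominateAll-packing : ∀ {k} vs {π} → Packing (suc k) π → Packing (suc k) (foldl dominate π vs)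
  dominateAll-packing []       packing = packing
  dominateAll-packing (v ∷ vs) packing = dominateAll-packing vs (dominate-packing packing)

  dominateAll-keeps-ones : ∀ vs π → OnesKept π (foldl dominate π vs)
  dominateAll-keeps-ones []       π w one = one
  dominateAll-keeps-ones (v ∷ vs) π w one =
    dominateAll-keeps-ones vs (dominate π v) w (dominate-keeps-ones π v w one)

  dominateAll-dominated : ∀ {vs v} π → v ∈ vs → Dominated (foldl dominate π vs) v
  dominateAll-dominated {v ∷ vs} π (here refl) =
    dominated-mono (dominateAll-keeps-ones vs (dominate π v)) (dominate-dominated π v)
  dominateAll-dominated {_ ∷ vs} π (there v∈vs) = dominateAll-dominated (dominate π _) v∈vs

  dominating-packing : ∀ {k π} → Packing (suc k) π → ∃[ π′ ] (Packing (suc k) π′ × Dominating π′)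
  dominating-packing {π = π} packing =
    foldl dominate π vertices , dominateAll-packing vertices packing ,
    λ (i , j) → dominateAll-dominated π (∈-cartesianProduct⁺ (∈-allFin i) (∈-allFin j))
    where
    vertices : List (V ℓ r)
    vertices = cartesianProduct (allFin _) (allFin _)

  Partner : ℕ → ℕ → Set
  Partner j j′ = IsRung j j′ ⊎ IsRung j′ j

  partner-unique : ∀ {j a b} → Partner j a → Partner j b → a ≡ b
  partner-unique (inj₁ (k , even , odd)) (inj₁ (k′ , even′ , odd′)) =
    trans odd (trans (cong (λ x → suc (2 * x)) (*-cancelˡ-≡ k k′ 2 (trans (sym even) even′))) (sym odd′))
  partner-unique (inj₁ (k , even , _)) (inj₂ (k′ , _ , odd′)) =
    contradiction (trans (sym even) odd′) (even≢odd k k′)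
  partner-unique (inj₂ (k , _ , odd)) (inj₁ (k′ , even′ , _)) =
    contradiction (trans (sym even′) odd) (even≢odd k′ k)
  partner-unique (inj₂ (k , even , odd)) (inj₂ (k′ , even′ , odd′)) =
    trans even (trans (cong (2 *_) (*-cancelˡ-≡ k k′ 2 (suc-injective (trans (sym odd) odd′)))) (sym even′))

  Neighbouring : ℕ → ℕ → Set
  Neighbouring a i = a ≡ suc i ⊎ suc a ≡ i

  Opposite : ℕ → ℕ → ℕ → Set
  Opposite i a b = (suc a ≡ i × b ≡ suc i) ⊎ (a ≡ suc i × suc b ≡ i)

  neighbouring-cases : ∀ {a b i} → Neighbouring a i → Neighbouring b i → a ≡ b ⊎ Opposite i a b
  neighbouring-cases (inj₁ a≡) (inj₁ b≡) = inj₁ (trans a≡ (sym b≡))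
  neighbouring-cases (inj₂ a≡) (inj₂ b≡) = inj₁ (suc-injective (trans a≡ (sym b≡)))
  neighbouring-cases (inj₂ a≡) (inj₁ b≡) = inj₂ (inj₁ (a≡ , b≡))
  neighbouring-cases (inj₁ a≡) (inj₂ b≡) = inj₂ (inj₂ (a≡ , b≡))

  inner-neighbour : ∀ {w u} → 1 ≤ row w → row w ≤ ℓ → Adj ℓ r w u →
    (row u ≡ row w × Partner (col w) (col u)) ⊎ (col u ≡ col w × Neighbouring (row u) (row w))
  inner-neighbour 1≤i _ (inj₁ (outer0 i≡0 _ _))         = contradiction (subst (1 ≤_) i≡0 1≤i) λ ()
  inner-neighbour _ i≤ℓ (inj₁ (outerL i≡1+ℓ _ _))       = contradiction (subst (_≤ ℓ) i≡1+ℓ i≤ℓ) (<-irrefl refl)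
  inner-neighbour _ _ (inj₁ (rung k _ _ same even odd)) = inj₁ (same , inj₁ (k , even , odd))
  inner-neighbour _ _ (inj₁ (spoke below same))         = inj₂ (same , inj₁ below)
  inner-neighbour 1≤i _ (inj₂ (outer0 _ i≡0 _))         = contradiction (subst (1 ≤_) i≡0 1≤i) λ ()
  inner-neighbour _ i≤ℓ (inj₂ (outerL _ i≡1+ℓ _))       = contradiction (subst (_≤ ℓ) i≡1+ℓ i≤ℓ) (<-irrefl refl)
  inner-neighbour _ _ (inj₂ (rung k _ _ same even odd)) = inj₁ (sym same , inj₂ (k , even , odd))
  inner-neighbour _ _ (inj₂ (spoke above same))         = inj₂ (sym same , inj₂ (sym above))

  vertical-one : ∀ {π w w′} → Dominating π → 1 ≤ row w → row w ≤ ℓ → Partner (col w) (col w′) →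
    row w′ ≡ row w → π w ≢ 1 → π w′ ≢ 1 → ∃[ u ] (π u ≡ 1 × col u ≡ col w × Neighbouring (row u) (row w))
  vertical-one {π} {w} dominating 1≤i i≤ℓ partner same-row w-free w′-free with dominating w
  ... | inj₁ one = contradiction one w-free
  ... | inj₂ (u , adj , one) with inner-neighbour 1≤i i≤ℓ adj
  ...   | inj₁ (u-row , u-partner) =
    contradiction (trans (cong π (vertex-≡ (trans same-row (sym u-row)) (partner-unique partner u-partner))) one)
                  w′-free
  ...   | inj₂ (u-col , u-neighbouring) = u , one , u-col , u-neighbouring

  record Rows (D : ℕ) (ring : Bool) : Set where
    field
      rowAt           : ℕ → ℕ
      rowAt-≤         : ∀ {d} → d ≤ D → rowAt d ≤ suc ℓ
      rowAt-step      : ∀ {d} → d < D → rowAt (suc d) ≡ suc (rowAt d) ⊎ rowAt d ≡ suc (rowAt (suc d))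
      rowAt-injective : ∀ {d d′} → d ≤ D → d′ ≤ D → rowAt d ≡ rowAt d′ → d ≡ d′
      rowAt-ring      : T ring → rowAt 0 ≡ 0 ⊎ rowAt 0 ≡ suc ℓ

  OneAt : (V ℓ r → ℕ) → ℕ → ℕ → Set
  OneAt π a b = ∃[ u ] (row u ≡ a × col u ≡ b × π u ≡ 1)

  NoOneAt : (V ℓ r → ℕ) → ℕ → ℕ → Set
  NoOneAt π a b = ∀ u → row u ≡ a → col u ≡ b → π u ≢ 1

  record Split (π : V ℓ r → ℕ) (a b i k : ℕ) : Set where
    field
      even-one  : OneAt π a (2 * k)
      odd-one   : OneAt π b (suc (2 * k))
      even-free : NoOneAt π i (2 * k)
      odd-free  : NoOneAt π i (suc (2 * k))

  split-rows : ∀ {π a b i a′ b′ i′ k} → a ≡ a′ → b ≡ b′ → i ≡ i′ → Split π a b i k → Split π a′ b′ i′ k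
  split-rows refl refl refl s = s

  module Embedding {k} (C : Columns r k) {D ring} (R : Rows D ring) where
    open Columns C
    open Rows R
    open Window D ring

    pairAt : Pair → ℕ
    pairAt previous = before
    pairAt current  = k
    pairAt next     = after

    pairAt-< : ∀ p → pairAt p < r
    pairAt-< previous = before<r
    pairAt-< current  = k<r
    pairAt-< next     = after<r

    pairAt-injective : ∀ p q → pairAt p ≡ pairAt q → p ≡ q
    pairAt-injective previous previous _ = refl
    pairAt-injective previous current  e = contradiction e before≢k
    pairAt-injective previous next     e = contradiction e before≢after
    pairAt-injective current  previous e = contradiction (sym e) before≢k
    pairAt-injective current  current  _ = refl
    pairAt-injective current  next     e = contradiction (sym e) after≢k
    pairAt-injective next     previous e = contradiction (sym e) before≢after
    pairAt-injective next     current  e = contradiction e after≢k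
    pairAt-injective next     next     _ = refl

    pairAt-follows : ∀ {p q} → Follows p q → SuccMod r (suc (2 * pairAt p)) (2 * pairAt q)
    pairAt-follows previous-current = before-follows
    pairAt-follows current-next     = after-follows

    colAt : Column → ℕ
    colAt (p , false) = 2 * pairAt p
    colAt (p , true)  = suc (2 * pairAt p)

    colAt-< : ∀ c → colAt c < 2 * r
    colAt-< (p , true)  = subst (_≤ 2 * r) (*-suc 2 (pairAt p)) (*-monoʳ-≤ 2 (pairAt-< p))
    colAt-< (p , false) = <-trans (n<1+n _) (colAt-< (p , true))

    colAt-injective : ∀ c c′ → colAt c ≡ colAt c′ → c ≡ c′
    colAt-injective (p , false) (q , false) e =
      cong (_, false) (pairAt-injective p q (*-cancelˡ-≡ (pairAt p) (pairAt q) 2 e))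
    colAt-injective (p , false) (q , true)  e = contradiction e (even≢odd (pairAt p) (pairAt q))
    colAt-injective (p , true)  (q , false) e = contradiction (sym e) (even≢odd (pairAt q) (pairAt p))
    colAt-injective (p , true)  (q , true)  e =
      cong (_, true) (pairAt-injective p q (*-cancelˡ-≡ (pairAt p) (pairAt q) 2 (suc-injective e)))

    ⟦_⟧ : Site → V ℓ r
    ⟦ d , c ⟧ = fromℕ< (s≤s (rowAt-≤ (Fin.toℕ≤pred[n] d))) , fromℕ< (colAt-< c)

    row-⟦⟧ : ∀ d c → row ⟦ d , c ⟧ ≡ rowAt (toℕ d)
    row-⟦⟧ d c = Fin.toℕ-fromℕ< _

    col-⟦⟧ : ∀ d c → col ⟦ d , c ⟧ ≡ colAt c
    col-⟦⟧ d c = Fin.toℕ-fromℕ< _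

    ⟦⟧-injective : ∀ {x y} → ⟦ x ⟧ ≡ ⟦ y ⟧ → x ≡ y
    ⟦⟧-injective {d , c} {d′ , c′} e = cong₂ _,_
      (Fin.toℕ-injective (rowAt-injective (Fin.toℕ≤pred[n] d) (Fin.toℕ≤pred[n] d′)
        (trans (sym (row-⟦⟧ d c)) (trans (cong row e) (row-⟦⟧ d′ c′)))))
      (colAt-injective c c′ (trans (sym (col-⟦⟧ d c)) (trans (cong col e) (col-⟦⟧ d′ c′))))

    ring-row : ∀ {d} c → toℕ d ≡ 0 → row ⟦ d , c ⟧ ≡ rowAt 0
    ring-row {d} c d≡0 = trans (row-⟦⟧ d c) (cong rowAt d≡0)

    ring-successive : ∀ d d′ {p q} → Follows p q → SuccMod r (col ⟦ d , p , true ⟧) (col ⟦ d′ , q , false ⟧)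
    ring-successive d d′ {p} {q} p→q =
      subst₂ (SuccMod r) (sym (col-⟦⟧ d (p , true))) (sym (col-⟦⟧ d′ (q , false))) (pairAt-follows p→q)

    edge-sound : ∀ x y → SiteEdge x y → Adj ℓ r ⟦ x ⟧ ⟦ y ⟧
    edge-sound (d , c) (d′ , _) (inj₁ (d′≡1+d , refl , refl))
      with rowAt-step (subst (_≤ D) d′≡1+d (Fin.toℕ≤pred[n] d′))
    ... | inj₁ down = inj₁ (spoke (begin
            row ⟦ d′ , c ⟧         ≡⟨ row-⟦⟧ d′ c ⟩
            rowAt (toℕ d′)         ≡⟨ cong rowAt d′≡1+d ⟩
            rowAt (suc (toℕ d))    ≡⟨ down ⟩
            suc (rowAt (toℕ d))    ≡⟨ cong suc (row-⟦⟧ d c) ⟨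
            suc (row ⟦ d , c ⟧)    ∎) refl)
      where open ≡-Reasoning
    ... | inj₂ up = inj₂ (spoke (begin
            row ⟦ d , c ⟧             ≡⟨ row-⟦⟧ d c ⟩
            rowAt (toℕ d)             ≡⟨ up ⟩
            suc (rowAt (suc (toℕ d))) ≡⟨ cong (suc ∘ rowAt) d′≡1+d ⟨
            suc (rowAt (toℕ d′))      ≡⟨ cong suc (row-⟦⟧ d′ c) ⟨
            suc (row ⟦ d′ , c ⟧)      ∎) refl)
      where open ≡-Reasoning
    edge-sound (d , p , _) (_ , _ , _) (inj₂ (inj₁ (refl , refl , refl , refl))) =
      pair-adjacent (pairAt p) refl (col-⟦⟧ d (p , false)) (col-⟦⟧ d (p , true))
    edge-sound (d , p , _) (d′ , q , _) (inj₂ (inj₂ (t , d≡0 , d′≡0 , p→q , refl , refl)))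
      with rowAt-ring t
    ... | inj₁ top    = inj₁ (outer0 (trans (ring-row (p , true) d≡0) top)
                                     (trans (ring-row (q , false) d′≡0) top)
                                     (ring-successive d d′ p→q))
    ... | inj₂ bottom = inj₁ (outerL (trans (ring-row (p , true) d≡0) bottom)
                                     (trans (ring-row (q , false) d′≡0) bottom)
                                     (ring-successive d d′ p→q))

    adj-sound : ∀ {x y} → SiteAdj x y → Adj ℓ r ⟦ x ⟧ ⟦ y ⟧
    adj-sound {x} {y} = [ edge-sound x y , swap ∘ edge-sound y x ]

    within-sound : ∀ n x y → T (within n x y) → DistLe ℓ r ⟦ x ⟧ ⟦ y ⟧ n
    within-sound zero    x y near with x ≟ₛ y
    ... | yes refl = 0 , z≤n , here
    within-sound (suc n) x y near with x ≟ₛ y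
    ... | yes refl = 0 , z≤n , here
    ... | no _     with satisfied (any⁻ _ (neighbours x) near)
    ...   | (z , adj) , near′ = distLe-step (adj-sound adj) (within-sound n z y near′)

    module _ {π} (packing : Packing 5 π) (sites : List Site) where

      σ : ℕ → ℕ
      σ m = π ⟦ siteAt sites m ⟧

      certified-respected : ∀ {m c} → Certified (siteAt sites) m c → src c < m × T (respects σ m c)
      certified-respected {m} {c} (s<m , distinct , near) = s<m , respects-intro σ m c λ same long →
        proj₂ packing _ _ (distinct ∘ ⟦⟧-injective) same
          (distLe-weaken (subst (len c ≤_) (sym same) long) (within-sound (len c) _ _ near))

      layers-satisfied : ∀ {m} (L : Layers (siteAt sites) m) → Satisfies σ m (forget L)
      layers-satisfied []       = tt
      layers-satisfied {m} (cs ∷ L) =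
        map⁺ (All.tabulate λ {(c , cert)} _ → certified-respected {m} {c} cert) , layers-satisfied L

      refuted-sound : Refutation sites → (∀ m → σ m ∈ choices m) → ⊥
      refuted-sound (refutation refuted) σ-choices =
        refutes-sound choices σ σ-choices (layers-satisfied (layers (siteAt sites) 0 (length sites))) (λ ())
          refuted

    split-refuted : ∀ {π e o c rest} → Refutation (split e o c rest) → Packing 5 π →
                    Split π (rowAt (toℕ e)) (rowAt (toℕ o)) (rowAt (toℕ c)) k → ⊥
    split-refuted {π} {e} {o} {c} {rest} refuted packing s = refuted-sound packing _ refuted choice
      where
      open Split s
      colour-range : ∀ x → π ⟦ x ⟧ ∈ 1 ∷ 2 ∷ 3 ∷ 4 ∷ 5 ∷ []
      colour-range x = one-to-five (proj₁ (proj₁ packing ⟦ x ⟧)) (proj₂ (proj₁ packing ⟦ x ⟧))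
      one : ∀ d c′ → OneAt π (rowAt (toℕ d)) (colAt c′) → π ⟦ d , c′ ⟧ ∈ 1 ∷ []
      one d c′ (u , u-row , u-col , u-one) =
        here (trans (cong π (vertex-≡ (trans (row-⟦⟧ d c′) (sym u-row)) (trans (col-⟦⟧ d c′) (sym u-col)))) u-one)
      other : ∀ d c′ → NoOneAt π (rowAt (toℕ d)) (colAt c′) → π ⟦ d , c′ ⟧ ∈ 2 ∷ 3 ∷ 4 ∷ 5 ∷ []
      other d c′ free with colour-range (d , c′)
      ... | here is-one = contradiction is-one (free _ (row-⟦⟧ d c′) (col-⟦⟧ d c′))
      ... | there m     = m
      choice : ∀ m → σ packing (split e o c rest) m ∈ choices m
      choice 0 = one e cur₀ even-one
      choice 1 = one o cur₁ odd-one
      choice 2 = other c cur₀ even-free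
      choice 3 = other c cur₁ odd-free
      choice (suc (suc (suc (suc m)))) = colour-range (siteAt rest m)

-- Rungs of H^ℓ(r)

module Rungs (ℓ r : ℕ) (3≤ℓ : 3 ≤ ℓ) (3≤r : 3 ≤ r) where
  open Graph ℓ r

  top-rows : Rows 4 true
  top-rows = record
    { rowAt           = λ d → d
    ; rowAt-≤         = λ d≤4 → ≤-trans d≤4 (s≤s 3≤ℓ)
    ; rowAt-step      = λ _ → inj₁ refl
    ; rowAt-injective = λ _ _ same → same
    ; rowAt-ring      = λ _ → inj₁ refl
    }

  bottom-rows : Rows 4 true
  bottom-rows = record
    { rowAt           = suc ℓ ∸_
    ; rowAt-≤         = λ {d} _ → m∸n≤m (suc ℓ) d
    ; rowAt-step      = λ d<4 → inj₂ (+-∸-assoc 1 (≤-trans (s≤s⁻¹ d<4) 3≤ℓ))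
    ; rowAt-injective = λ d≤4 d′≤4 → ∸-cancelˡ-≡ (≤-trans d≤4 (s≤s 3≤ℓ)) (≤-trans d′≤4 (s≤s 3≤ℓ))
    ; rowAt-ring      = λ _ → inj₂ refl
    }

  middle-rows : ∀ m → 6 + m ≤ suc ℓ → Rows 6 false
  middle-rows m fits = record
    { rowAt           = _+ m
    ; rowAt-≤         = λ d≤6 → ≤-trans (+-monoˡ-≤ m d≤6) fits
    ; rowAt-step      = λ _ → inj₁ refl
    ; rowAt-injective = λ _ _ → +-cancelʳ-≡ m _ _
    ; rowAt-ring      = λ ()
    }

  data Position : ℕ → Set where
    first       : Position 1
    second      : Position 2
    last        : ∀ {i} → i ≡ ℓ → Position i
    penultimate : ∀ {i} → suc i ≡ ℓ → Position i
    middle      : ∀ m → 6 + m ≤ suc ℓ → Position (3 + m)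

  position : ∀ {i} → 1 ≤ i → i ≤ ℓ → Position i
  position {1} _ _ = first
  position {2} _ _ = second
  position {suc (suc (suc m))} _ i≤ℓ with suc (suc (suc m)) ≟ ℓ | suc (suc (suc (suc m))) ≟ ℓ
  ... | yes i≡ℓ | _          = last i≡ℓ
  ... | no _    | yes 1+i≡ℓ = penultimate 1+i≡ℓ
  ... | no i≢ℓ  | no 1+i≢ℓ  = middle m (s≤s (≤∧≢⇒< (≤∧≢⇒< i≤ℓ i≢ℓ) 1+i≢ℓ))

  refute : ∀ {k D ring π e o c rest} → k < r → (R : Rows D ring) →
    Window.Refutation D ring (Window.split D ring e o c rest) → Packing 5 π →
    Split π (Rows.rowAt R (toℕ e)) (Rows.rowAt R (toℕ o)) (Rows.rowAt R (toℕ c)) k → ⊥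
  refute k<r R = Embedding.split-refuted (cyclic-columns 3≤r k<r) R

  -- The bottom window is the top one upside down, so there the certificates swap above and below.
  split-free : ∀ {π a b i k} → Packing 5 π → 1 ≤ i → i ≤ ℓ → k < r → Opposite i a b → Split π a b i k → ⊥
  split-free packing 1≤i i≤ℓ k<r opposite s with position 1≤i i≤ℓ | opposite
  ... | first  | inj₁ (refl , refl) = refute k<r top-rows rim-1-even-above packing s
  ... | first  | inj₂ (refl , refl) = refute k<r top-rows rim-1-even-below packing s
  ... | second | inj₁ (refl , refl) = refute k<r top-rows rim-2-even-above packing s
  ... | second | inj₂ (refl , refl) = refute k<r top-rows rim-2-even-below packing s
  ... | middle m fits | inj₁ (refl , refl) = refute k<r (middle-rows m fits) middle-even-above packing s
  ... | middle m fits | inj₂ (refl , refl) = refute k<r (middle-rows m fits) middle-even-below packing s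
  ... | last i≡ℓ | inj₁ (1+a≡i , b≡1+i) = refute k<r bottom-rows rim-1-even-below packing
    (split-rows (cong (_∸ 1) (trans 1+a≡i i≡ℓ)) (trans b≡1+i (cong suc i≡ℓ)) i≡ℓ s)
  ... | last i≡ℓ | inj₂ (a≡1+i , 1+b≡i) = refute k<r bottom-rows rim-1-even-above packing
    (split-rows (trans a≡1+i (cong suc i≡ℓ)) (cong (_∸ 1) (trans 1+b≡i i≡ℓ)) i≡ℓ s)
  ... | penultimate 1+i≡ℓ | inj₁ (1+a≡i , b≡1+i) = refute k<r bottom-rows rim-2-even-below packing
    (split-rows (cong (_∸ 2) (trans (cong suc 1+a≡i) 1+i≡ℓ)) (trans b≡1+i 1+i≡ℓ) (cong (_∸ 1) 1+i≡ℓ) s)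
  ... | penultimate 1+i≡ℓ | inj₂ (a≡1+i , 1+b≡i) = refute k<r bottom-rows rim-2-even-above packing
    (split-rows (trans a≡1+i 1+i≡ℓ) (cong (_∸ 2) (trans (cong suc 1+b≡i) 1+i≡ℓ)) (cong (_∸ 1) 1+i≡ℓ) s)

  free-at : ∀ {π w a b} → row w ≡ a → col w ≡ b → π w ≢ 1 → NoOneAt π a b
  free-at {π} w-row w-col free v v-row v-col =
    subst (λ x → π x ≢ 1) (vertex-≡ (trans w-row (sym v-row)) (trans w-col (sym v-col))) free

  rung-has-one : ∀ {π} → Packing 5 π → Dominating π →
    ∀ (i : Fin (suc (suc ℓ))) (k : ℕ) (j j′ : Fin (2 * r)) →
    1 ≤ toℕ i → toℕ i ≤ ℓ → toℕ j ≡ 2 * k → toℕ j′ ≡ suc (2 * k) → π (i , j) ≡ 1 ⊎ π (i , j′) ≡ 1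
  rung-has-one {π} packing dominating i k j j′ 1≤i i≤ℓ even odd with π (i , j) ≟ 1 | π (i , j′) ≟ 1
  ... | yes one | _       = inj₁ one
  ... | no _    | yes one = inj₂ one
  ... | no free | no free′
    with vertical-one dominating 1≤i i≤ℓ (inj₁ (k , even , odd)) refl free free′
       | vertical-one dominating 1≤i i≤ℓ (inj₂ (k , even , odd)) refl free′ free
  ...   | u , one , u-col , u-step | u′ , one′ , u′-col , u′-step with neighbouring-cases u-step u′-step
  ...     | inj₁ same-row =
    ⊥-elim (ones-nonadjacent packing (pair-adjacent k (sym same-row) (trans u-col even) (trans u′-col odd))
                             one one′)
  ...     | inj₂ opposite = ⊥-elim (split-free packing 1≤i i≤ℓ k<r opposite record
    { even-one  = u , refl , trans u-col even , one
    ; odd-one   = u′ , refl , trans u′-col odd , one′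
    ; even-free = free-at refl even free
    ; odd-free  = free-at refl odd free′
    })
    where
    k<r : k < r
    k<r = *-cancelˡ-< 2 k r (subst (_< 2 * r) even (Fin.toℕ<n j))

corollary12 : (ℓ r : ℕ) → 3 ≤ ℓ → 3 ≤ r → ChiRhoLe ℓ r 5 →
    ∃[ π ] (IsPackingColouring ℓ r 5 π ×
      (∀ (i : Fin (suc (suc ℓ))) (k : ℕ) (j j' : Fin (2 * r)) →
        1 ≤ toℕ i → toℕ i ≤ ℓ → toℕ j ≡ 2 * k → toℕ j' ≡ suc (2 * k) →
        (π (i , j) ≡ 1) ⊎ (π (i , j') ≡ 1)))
corollary12 ℓ r 3≤ℓ 3≤r (k , k≤5 , π , packing)
  with Graph.dominating-packing ℓ r (Graph.packing-mono ℓ r k≤5 packing)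
... | π′ , packing′ , dominating = π′ , packing′ , Rungs.rung-has-one ℓ r 3≤ℓ 3≤r packing′ dominating
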